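{- Let $d\ge1$, $k_1,\dots,k_d\ge1$, $n=k_1+\dots+k_d$. For $1\le i\le d$ let $C_i=\mathrm{Circ}(c_{i,0},\dots,c_{i,k_i-1})\in\mathbb{C}^{k_i\times k_i}$, and for $i\ne j$ let $a_{i,j}\in\mathbb{C}$. Let $A$ be the $n\times n$ block matrix whose $(i,i)$ block is $C_i$ and whose $(i,j)$ block ($i\ne j$) is the $k_i\times k_j$ matrix with all entries $a_{i,j}$, and let $\overline{A}$ be the $d\times d$ matrix with $\overline{A}_{ii}=\sum_{m=0}^{k_i-1}c_{i,m}$ and $\overline{A}_{ij}=a_{i,j}k_j$ for $i\ne j$. Let $\{u_1,\dots,u_d\}$ be a basis of $\mathbb{C}^d$ consisting of generalized eigenvectors of $\overline{A}$. Then the set consisting of the vectors $w_{i,j}$ ($1\le i\le d$, $1\le j\le k_i-1$) together with $u_1^\otimes,\dots,u_d^\otimes$ is linearly independent.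
   Context: $\mathrm{Circ}(c_0,\dots,c_{k-1})$ is the $k\times k$ matrix whose $(r,s)$ entry (indices $0,\dots,k-1$) is $c_{(r-s)\bmod k}$. $\omega_k$ denotes a fixed primitive $k$-th root of unity and $v_{k,j}=(1,\omega_k^j,\dots,\omega_k^{(k-1)j})^T$. The vector $w_{i,j}\in\mathbb{C}^n$ has coordinates $v_{k_i,j}$ in the $i$-th block (positions $k_1+\dots+k_{i-1}+1$ through $k_1+\dots+k_i$) and $0$ elsewhere; it is an eigenvector of $A$. For $u=(x_1,\dots,x_d)^T\in\mathbb{C}^d$, its tensor expansion is $u^\otimes=(x_1,\dots,x_1,\dots,x_d,\dots,x_d)^T\in\mathbb{C}^n$, where $x_i$ is repeated $k_i$ times. -}

module Defs where

open import Level using (Level; _⊔_)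
open import Data.Nat as ℕ using (ℕ; zero; suc; _∸_)
open import Data.Fin using (Fin; zero; suc; toℕ)
open import Data.Product using (Σ; ∃; _×_; _,_)
open import Relation.Nullary using (¬_)
open import Relation.Binary.PropositionalEquality using (_≡_)
open import Algebra.Bundles using (CommutativeRing)

-- Everything is over an abstract commutative ring R which is assumed to be an
-- algebraically closed field of characteristic 0 (standing in for ℂ,
-- which does not exist in agda-stdlib).
module _ {c ℓ : Level} (R : CommutativeRing c ℓ) where
  open CommutativeRing R using (_≈_; _+_; _*_; _-_; 0#; 1#) renaming (Carrier to K)

  ∑ : (m : ℕ) → (Fin m → K) → K
  ∑ zero    f = 0#
  ∑ (suc m) f = f zero + ∑ m (λ i → f (suc i))

  pow : K → ℕ → K
  pow x zero    = 1#
  pow x (suc m) = x * pow x m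

  natK : ℕ → K
  natK zero    = 0#
  natK (suc m) = 1# + natK m

  record IsACF0 : Set (c ⊔ ℓ) where
    field
      nontrivial : ¬ (1# ≈ 0#)
      inverse    : ∀ x → ¬ (x ≈ 0#) → ∃ λ y → x * y ≈ 1#
      char0      : ∀ m → ¬ (natK (suc m) ≈ 0#)
      algClosed  : ∀ m (a : Fin (suc m) → K) →
                   ∃ λ x → pow x (suc m) + ∑ (suc m) (λ i → a i * pow x (toℕ i)) ≈ 0#

  IsPrimitiveRoot : ℕ → K → Set ℓ
  IsPrimitiveRoot k ω = (pow ω k ≈ 1#) × (∀ j → 1 ℕ.≤ j → j ℕ.< k → ¬ (pow ω j ≈ 1#))

  Vec' : ℕ → Set c
  Vec' d = Fin d → K

  Mat : ℕ → Set c
  Mat d = Fin d → Fin d → K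

  _·ᵥ_ : {d : ℕ} → Mat d → Vec' d → Vec' d
  (M ·ᵥ v) r = ∑ _ (λ s → M r s * v s)

  shift : {d : ℕ} → Mat d → K → Mat d
  shift M λ' r s with r Data.Fin.≟ s
  ... | Relation.Nullary.yes _ = M r s - λ'
  ... | Relation.Nullary.no  _ = M r s

  iter : {d : ℕ} → Mat d → ℕ → Vec' d → Vec' d
  iter M zero    v = v
  iter M (suc m) v = M ·ᵥ iter M m v

  IsZeroVec : {d : ℕ} → Vec' d → Set ℓ
  IsZeroVec v = ∀ r → v r ≈ 0#

  IsGenEigenvector : {d : ℕ} → Mat d → Vec' d → Set (c ⊔ ℓ)
  IsGenEigenvector M v =
    ¬ IsZeroVec v × Σ K λ λ' → Σ ℕ λ m → IsZeroVec (iter (shift M λ') m v)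

  LinIndep : {m d : ℕ} → (Fin m → Vec' d) → Set (c ⊔ ℓ)
  LinIndep {m} u = ∀ (a : Fin m → K) →
    IsZeroVec (λ r → ∑ m (λ l → a l * u l r)) → ∀ l → a l ≈ 0#

  Spans : {m d : ℕ} → (Fin m → Vec' d) → Set (c ⊔ ℓ)
  Spans {m} {d} u = ∀ (v : Vec' d) → Σ (Fin m → K) λ a → ∀ r → ∑ m (λ l → a l * u l r) ≈ v r

  IsBasis : {m d : ℕ} → (Fin m → Vec' d) → Set (c ⊔ ℓ)
  IsBasis u = LinIndep u × Spans u

  -- Block data. d blocks of sizes k : Fin d → ℕ; n = ∑ k i.
  -- A vector of K^n is represented block-wise as
  --   (i : Fin d) → Fin (k i) → K,
  -- position r of block i being global coordinate k₁+…+k_{i-1}+r+1.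
  BlockVec : (d : ℕ) → (Fin d → ℕ) → Set c
  BlockVec d k = (i : Fin d) → Fin (k i) → K

  -- Ā : d×d,  Ā_ii = ∑_{m<k_i} c_{i,m},  Ā_ij = a_{ij} k_j (i ≠ j)
  -- circulant C_i has first column c i : Fin (k i) → K
  Abar : (d : ℕ) (k : Fin d → ℕ) (cc : (i : Fin d) → Fin (k i) → K)
         (a : Fin d → Fin d → K) → Mat d
  Abar d k cc a i j with i Data.Fin.≟ j
  ... | Relation.Nullary.yes _ = ∑ (k i) (cc i)
  ... | Relation.Nullary.no  _ = a i j * natK (k j)

  vkj : (k : ℕ) → K → ℕ → Fin k → K
  vkj k ω j r = pow ω (toℕ r ℕ.* j)

  -- w_{i,j}: v_{k_i,j} in block i, zero elsewhere (ω k = chosen primitive k-th root)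
  w : (d : ℕ) (k : Fin d → ℕ) (ω : ℕ → K) (i : Fin d) (j : ℕ) → BlockVec d k
  w d k ω i j i' r with i Data.Fin.≟ i'
  ... | Relation.Nullary.yes _ = vkj (k i') (ω (k i')) j r
  ... | Relation.Nullary.no  _ = 0#

  tensorExp : (d : ℕ) (k : Fin d → ℕ) → Vec' d → BlockVec d k
  tensorExp d k u i r = u i

  -- Linear independence of the family
  --   { w_{i,j} : i ∈ Fin d, 1 ≤ j ≤ k_i - 1 } ∪ { u_l^⊗ : l ∈ Fin d }
  -- (j = 1 + toℕ t with t : Fin (k i ∸ 1)).
  FamilyLinIndep : (d : ℕ) (k : Fin d → ℕ) (ω : ℕ → K) (u : Fin d → Vec' d) → Set (c ⊔ ℓ)
  FamilyLinIndep d k ω u =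
    ∀ (α : (i : Fin d) → Fin (k i ∸ 1) → K) (β : Fin d → K) →
    (∀ (i' : Fin d) (r : Fin (k i')) →
       ∑ d (λ i → ∑ (k i ∸ 1) (λ t → α i t * w d k ω i (suc (toℕ t)) i' r))
       + ∑ d (λ l → β l * tensorExp d k (u l) i' r) ≈ 0#) →
    (∀ i t → α i t ≈ 0#) × (∀ l → β l ≈ 0#)

{-# OPTIONS --safe #-}
-- On the i-th block, a vanishing combination of the family says that the vector
-- x = (∑_l β_l (u_l)_i , α_{i,1} , … , α_{i,k_i-1}) satisfies ∑_j x_j ω^{rj} = 0
-- for every r, i.e. x lies in the kernel of the discrete Fourier matrix of size k_i.
-- That matrix is invertible: multiplying the r-th equation by ω^{r(k-s)} and summing
-- over r leaves k·x_s, because the geometric sum of a k-th root of unity z ≠ 1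
-- vanishes ((z - 1)·∑_{r<k} z^r = z^k - 1), and k ≠ 0 in characteristic zero. Hence all α vanish and ∑_l β_l u_l = 0,
-- so β = 0 by the independence of the u_l. Only that independence is used: neither
-- the spanning half of the basis hypothesis nor the generalised eigenvector property
-- (nor algebraic closure) plays a role.
module Submission where

open import Defs
open import Level using (Level)
open import Data.Nat using (ℕ; _≤_)
open import Data.Fin using (Fin)
open import Algebra.Bundles using (CommutativeRing)

open import Data.Nat as ℕ using (zero; suc; _∸_; _<_)
import Data.Nat.Properties as ℕ
open import Data.Fin as Fin using (toℕ; fromℕ; inject₁)
import Data.Fin.Properties as Fin
open import Data.Vec.Functional using (Vector; _∷_)
open import Data.Product using (_×_; _,_; proj₁; proj₂; ∃)
open import Data.Empty using (⊥-elim)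
open import Function using (_∘_)
open import Relation.Nullary using (¬_; yes; no)
open import Relation.Binary.Definitions using (tri<; tri≈; tri>)
open import Relation.Binary.PropositionalEquality as ≡ using (_≡_; _≢_)
import Algebra.Definitions as AlgebraDefinitions

module _ {c ℓ : Level} (R : CommutativeRing c ℓ) where
  open CommutativeRing R renaming (Carrier to K)
  open AlgebraDefinitions _≈_ using (AlmostLeftCancellative)
  open import Algebra.Properties.Semiring.Sum semiring
  open import Algebra.Properties.Semiring.Exp semiring
  open import Algebra.Properties.Ring ring using (-1*x≈-x)
  open import Algebra.Properties.Group +-group using (x∙y⁻¹≈ε⇒x≈y; ∙-cancelʳ)
  open import Relation.Binary.Reasoning.Setoid setoid

  ∑≡sum : ∀ m (f : Vector K m) → ∑ R m f ≡ sum f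
  ∑≡sum zero    f = ≡.refl
  ∑≡sum (suc m) f = ≡.cong (f Fin.zero +_) (∑≡sum m (f ∘ Fin.suc))

  pow≡^ : ∀ x n → pow R x n ≡ x ^ n
  pow≡^ x zero    = ≡.refl
  pow≡^ x (suc n) = ≡.cong (x *_) (pow≡^ x n)

  natK≡sum1 : ∀ m → natK R m ≡ ∑[ r < m ] 1#
  natK≡sum1 zero    = ≡.refl
  natK≡sum1 (suc m) = ≡.cong (1# +_) (natK≡sum1 m)

  inverse⇒almostCancelˡ : (∀ x → ¬ x ≈ 0# → ∃ λ y → x * y ≈ 1#) → AlmostLeftCancellative 0# _*_
  inverse⇒almostCancelˡ inverse x y z x≉0 xy≈xz with inverse x x≉0
  ... | x⁻¹ , xx⁻¹≈1 = begin
    y                 ≈⟨ *-identityˡ y ⟨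
    1# * y            ≈⟨ *-congʳ (trans (*-comm x⁻¹ x) xx⁻¹≈1) ⟨
    (x⁻¹ * x) * y     ≈⟨ *-assoc x⁻¹ x y ⟩
    x⁻¹ * (x * y)     ≈⟨ *-congˡ xy≈xz ⟩
    x⁻¹ * (x * z)     ≈⟨ *-assoc x⁻¹ x z ⟨
    (x⁻¹ * x) * z     ≈⟨ *-congʳ (trans (*-comm x⁻¹ x) xx⁻¹≈1) ⟩
    1# * z            ≈⟨ *-identityˡ z ⟩
    z                 ∎

  sum-zero : ∀ {n} (f : Vector K n) → (∀ i → f i ≈ 0#) → sum f ≈ 0#
  sum-zero {n} f f≈0 = trans (sum-cong-≋ f≈0) (sum-replicate-zero n)

  sum-select : ∀ {n} (f : Vector K n) s → (∀ j → j ≢ s → f j ≈ 0#) → sum f ≈ f s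
  sum-select {suc n} f Fin.zero off = begin
    f Fin.zero + sum (f ∘ Fin.suc) ≈⟨ +-congˡ (sum-zero _ (λ j → off (Fin.suc j) λ ())) ⟩
    f Fin.zero + 0#                ≈⟨ +-identityʳ _ ⟩
    f Fin.zero                     ∎
  sum-select {suc n} f (Fin.suc s) off = begin
    f Fin.zero + sum (f ∘ Fin.suc)
      ≈⟨ +-cong (off Fin.zero λ ())
                (sum-select _ s λ j j≢s → off (Fin.suc j) (j≢s ∘ Fin.suc-injective)) ⟩
    0# + f (Fin.suc s)             ≈⟨ +-identityˡ _ ⟩
    f (Fin.suc s)                  ∎

  1^n≈1 : ∀ n → 1# ^ n ≈ 1#
  1^n≈1 zero    = refl
  1^n≈1 (suc n) = trans (*-identityˡ _) (1^n≈1 n)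

  ^-root : ∀ {x} k m → x ^ k ≈ 1# → (x ^ m) ^ k ≈ 1#
  ^-root {x} k m xᵏ≈1 = begin
    (x ^ m) ^ k    ≈⟨ ^-assocʳ x m k ⟩
    x ^ (m ℕ.* k)  ≈⟨ ^-congʳ x (ℕ.*-comm m k) ⟩
    x ^ (k ℕ.* m)  ≈⟨ ^-assocʳ x k m ⟨
    (x ^ k) ^ m    ≈⟨ ^-congˡ m xᵏ≈1 ⟩
    1# ^ m         ≈⟨ 1^n≈1 m ⟩
    1#             ∎

  geometric-sum : ∀ z k → z * ∑[ r < k ] (z ^ toℕ r) + 1# ≈ ∑[ r < k ] (z ^ toℕ r) + z ^ k
  geometric-sum z k = begin
    z * ∑[ r < k ] (z ^ toℕ r) + 1#               ≈⟨ +-comm _ 1# ⟩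
    1# + z * ∑[ r < k ] (z ^ toℕ r)               ≈⟨ +-congˡ (*-distribˡ-sum {k} z _) ⟩
    ∑[ r < suc k ] (z ^ toℕ r)                    ≈⟨ sum-init-last {k} (λ r → z ^ toℕ r) ⟩
    ∑[ r < k ] (z ^ toℕ (inject₁ r)) + z ^ toℕ (fromℕ k)
      ≈⟨ +-cong (sum-cong-≋ {k} (^-congʳ z ∘ Fin.toℕ-inject₁)) (^-congʳ z (Fin.toℕ-fromℕ k)) ⟩
    ∑[ r < k ] (z ^ toℕ r) + z ^ k                ∎

  root-of-unity-sum : AlmostLeftCancellative 0# _*_ → ∀ {z} k → z ^ k ≈ 1# → ¬ z ≈ 1# →
                      ∑[ r < k ] (z ^ toℕ r) ≈ 0#
  root-of-unity-sum cancel {z} k zᵏ≈1 z≉1 =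
    cancel (z - 1#) G 0# (z≉1 ∘ x∙y⁻¹≈ε⇒x≈y z 1#) (trans [z-1]G≈0 (sym (zeroʳ _)))
    where
    G = ∑[ r < k ] (z ^ toℕ r)
    zG≈G : z * G ≈ G
    zG≈G = ∙-cancelʳ 1# (z * G) G (trans (geometric-sum z k) (+-congˡ zᵏ≈1))
    [z-1]G≈0 : (z - 1#) * G ≈ 0#
    [z-1]G≈0 = begin
      (z - 1#) * G        ≈⟨ distribʳ G z (- 1#) ⟩
      z * G + - 1# * G    ≈⟨ +-cong zG≈G (-1*x≈-x G) ⟩
      G - G               ≈⟨ -‿inverseʳ G ⟩
      0#                  ∎

  module PrimitiveRoot {k : ℕ} {ω : K} (ω-primitive : IsPrimitiveRoot R k ω) where

    ωᵏ≈1 : ω ^ k ≈ 1#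
    ωᵏ≈1 = trans (reflexive (≡.sym (pow≡^ ω k))) (proj₁ ω-primitive)

    ωʲ≉1 : ∀ j → 1 ≤ j → j < k → ¬ ω ^ j ≈ 1#
    ωʲ≉1 j 1≤j j<k ωʲ≈1 = proj₂ ω-primitive j 1≤j j<k (trans (reflexive (pow≡^ ω j)) ωʲ≈1)

    -- ω^(j + (k ∸ s)) stands for ω^(j - s), avoiding negative exponents.
    diff : Fin k → Fin k → ℕ
    diff s j = toℕ j ℕ.+ (k ∸ toℕ s)

    s+[k∸s]≡k : ∀ (s : Fin k) → diff s s ≡ k
    s+[k∸s]≡k s = ℕ.m+[n∸m]≡n (ℕ.<⇒≤ (Fin.toℕ<n s))

    ω^diff≈1 : ∀ s → ω ^ diff s s ≈ 1#
    ω^diff≈1 s = trans (^-congʳ ω (s+[k∸s]≡k s)) ωᵏ≈1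

    ω^diff≉1 : ∀ s j → j ≢ s → ¬ ω ^ diff s j ≈ 1#
    ω^diff≉1 s j j≢s with ℕ.<-cmp (toℕ j) (toℕ s)
    ... | tri≈ _ j≡s _ = ⊥-elim (j≢s (Fin.toℕ-injective j≡s))
    ... | tri< j<s _ _ = ωʲ≉1 (diff s j) 1≤diff diff<k
      where
      1≤diff : 1 ≤ diff s j
      1≤diff = ℕ.≤-trans (ℕ.m<n⇒0<n∸m (Fin.toℕ<n s)) (ℕ.m≤n+m (k ∸ toℕ s) (toℕ j))
      diff<k : diff s j < k
      diff<k = ≡.subst (diff s j <_) (s+[k∸s]≡k s) (ℕ.+-monoˡ-< (k ∸ toℕ s) j<s)
    ... | tri> _ _ s<j = λ ω^diff≈1 → ωʲ≉1 (toℕ j ∸ toℕ s) (ℕ.m<n⇒0<n∸m s<j)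
          (ℕ.≤-<-trans (ℕ.m∸n≤m (toℕ j) (toℕ s)) (Fin.toℕ<n j)) (begin
            ω ^ (toℕ j ∸ toℕ s)                 ≈⟨ *-identityʳ _ ⟨
            ω ^ (toℕ j ∸ toℕ s) * 1#            ≈⟨ *-congˡ ωᵏ≈1 ⟨
            ω ^ (toℕ j ∸ toℕ s) * ω ^ k         ≈⟨ ^-homo-* ω (toℕ j ∸ toℕ s) k ⟨
            ω ^ ((toℕ j ∸ toℕ s) ℕ.+ k)         ≈⟨ ^-congʳ ω (≡.sym diff≡) ⟩
            ω ^ diff s j                       ≈⟨ ω^diff≈1 ⟩
            1#                                  ∎)
      where
      diff≡ : diff s j ≡ (toℕ j ∸ toℕ s) ℕ.+ k
      diff≡ = ≡.trans (≡.cong (ℕ._+ (k ∸ toℕ s)) (≡.sym (ℕ.m∸n+n≡m (ℕ.<⇒≤ s<j))))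
               (≡.trans (ℕ.+-assoc (toℕ j ∸ toℕ s) (toℕ s) (k ∸ toℕ s))
                        (≡.cong ((toℕ j ∸ toℕ s) ℕ.+_) (s+[k∸s]≡k s)))

  dft-swap : ∀ {k} (x : Vector K k) ω a →
    ∑[ r < k ] ((∑[ j < k ] (x j * ω ^ (toℕ r ℕ.* toℕ j))) * ω ^ (toℕ r ℕ.* a))
    ≈ ∑[ j < k ] (x j * ∑[ r < k ] ((ω ^ (toℕ j ℕ.+ a)) ^ toℕ r))
  dft-swap {k} x ω a = begin
    ∑[ r < k ] ((∑[ j < k ] (x j * ω ^ (toℕ r ℕ.* toℕ j))) * ω ^ (toℕ r ℕ.* a))
      ≈⟨ sum-cong-≋ {k} (λ r → *-distribʳ-sum {k} _ _) ⟩
    ∑[ r < k ] ∑[ j < k ] ((x j * ω ^ (toℕ r ℕ.* toℕ j)) * ω ^ (toℕ r ℕ.* a))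
      ≈⟨ ∑-comm {k} {k} _ ⟩
    ∑[ j < k ] ∑[ r < k ] ((x j * ω ^ (toℕ r ℕ.* toℕ j)) * ω ^ (toℕ r ℕ.* a))
      ≈⟨ sum-cong-≋ {k} (λ j → sum-cong-≋ {k} (λ r → term j r)) ⟩
    ∑[ j < k ] ∑[ r < k ] (x j * (ω ^ (toℕ j ℕ.+ a)) ^ toℕ r)
      ≈⟨ sum-cong-≋ {k} (λ j → *-distribˡ-sum {k} (x j) _) ⟨
    ∑[ j < k ] (x j * ∑[ r < k ] ((ω ^ (toℕ j ℕ.+ a)) ^ toℕ r)) ∎
    where
    term : ∀ j r → (x j * ω ^ (toℕ r ℕ.* toℕ j)) * ω ^ (toℕ r ℕ.* a)
                   ≈ x j * (ω ^ (toℕ j ℕ.+ a)) ^ toℕ r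
    term j r = begin
      (x j * ω ^ (toℕ r ℕ.* toℕ j)) * ω ^ (toℕ r ℕ.* a)
        ≈⟨ *-assoc _ _ _ ⟩
      x j * (ω ^ (toℕ r ℕ.* toℕ j) * ω ^ (toℕ r ℕ.* a))
        ≈⟨ *-congˡ (^-homo-* ω (toℕ r ℕ.* toℕ j) (toℕ r ℕ.* a)) ⟨
      x j * ω ^ (toℕ r ℕ.* toℕ j ℕ.+ toℕ r ℕ.* a)
        ≈⟨ *-congˡ (^-congʳ ω exponent) ⟩
      x j * ω ^ ((toℕ j ℕ.+ a) ℕ.* toℕ r)
        ≈⟨ *-congˡ (^-assocʳ ω (toℕ j ℕ.+ a) (toℕ r)) ⟨
      x j * (ω ^ (toℕ j ℕ.+ a)) ^ toℕ r
        ∎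
      where
      exponent : toℕ r ℕ.* toℕ j ℕ.+ toℕ r ℕ.* a ≡ (toℕ j ℕ.+ a) ℕ.* toℕ r
      exponent = ≡.trans (≡.sym (ℕ.*-distribˡ-+ (toℕ r) (toℕ j) a)) (ℕ.*-comm (toℕ r) _)

  dft-injective : AlmostLeftCancellative 0# _*_ → ∀ {k ω} → ¬ natK R k ≈ 0# →
    IsPrimitiveRoot R k ω → (x : Vector K k) →
    (∀ (r : Fin k) → ∑[ j < k ] (x j * ω ^ (toℕ r ℕ.* toℕ j)) ≈ 0#) → ∀ s → x s ≈ 0#
  dft-injective cancel {k} {ω} k≉0 ω-primitive x dft≈0 s =
    cancel (natK R k) (x s) 0# k≉0 (trans kxₛ≈0 (sym (zeroʳ _)))
    where
    open PrimitiveRoot ω-primitive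
    kxₛ≈0 : natK R k * x s ≈ 0#
    kxₛ≈0 = begin
      natK R k * x s
        ≈⟨ *-comm _ _ ⟩
      x s * natK R k
        ≈⟨ *-congˡ (reflexive (natK≡sum1 k)) ⟩
      x s * ∑[ r < k ] 1#
        ≈⟨ *-congˡ (sum-cong-≋ {k} λ r →
             sym (trans (^-congˡ (toℕ r) (ω^diff≈1 s)) (1^n≈1 (toℕ r)))) ⟩
      x s * ∑[ r < k ] ((ω ^ diff s s) ^ toℕ r)
        ≈⟨ sum-select {k} _ s (λ j j≢s → trans (*-congˡ {x j} (root-of-unity-sum cancel k
             (^-root k (diff s j) ωᵏ≈1) (ω^diff≉1 s j j≢s))) (zeroʳ (x j))) ⟨
      ∑[ j < k ] (x j * ∑[ r < k ] ((ω ^ diff s j) ^ toℕ r))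
        ≈⟨ dft-swap x ω (k ∸ toℕ s) ⟨
      ∑[ r < k ] ((∑[ j < k ] (x j * ω ^ (toℕ r ℕ.* toℕ j))) * ω ^ (toℕ r ℕ.* (k ∸ toℕ s)))
        ≈⟨ sum-zero {k} _ (λ r → trans (*-congʳ (dft≈0 r)) (zeroˡ _)) ⟩
      0# ∎

  fourier-basis-independent : AlmostLeftCancellative 0# _*_ → ∀ {k ω} → ¬ natK R k ≈ 0# →
    IsPrimitiveRoot R k ω → (γ : K) (α : Vector K (k ∸ 1)) →
    (∀ (r : Fin k) → ∑[ t < k ∸ 1 ] (α t * ω ^ (toℕ r ℕ.* suc (toℕ t))) + γ ≈ 0#) →
    γ ≈ 0# × (∀ t → α t ≈ 0#)
  fourier-basis-independent cancel {zero}      0≉0 _ _ _ _ = ⊥-elim (0≉0 refl)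
  fourier-basis-independent cancel {suc k} {ω} k≉0 ω-primitive γ α relation =
    coefficient≈0 Fin.zero , coefficient≈0 ∘ Fin.suc
    where
    coefficient≈0 = dft-injective cancel k≉0 ω-primitive (γ ∷ α) λ r → begin
      γ * ω ^ (toℕ r ℕ.* 0) + ∑[ t < k ] (α t * ω ^ (toℕ r ℕ.* suc (toℕ t)))
        ≈⟨ +-congʳ (trans (*-congˡ (^-congʳ ω (ℕ.*-zeroʳ (toℕ r)))) (*-identityʳ γ)) ⟩
      γ + ∑[ t < k ] (α t * ω ^ (toℕ r ℕ.* suc (toℕ t)))
        ≈⟨ +-comm _ _ ⟩
      ∑[ t < k ] (α t * ω ^ (toℕ r ℕ.* suc (toℕ t))) + γ
        ≈⟨ relation r ⟩
      0# ∎

  module _ {d : ℕ} {k : Fin d → ℕ} {ω : ℕ → K} where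

    w-diagonal : ∀ i j r → w R d k ω i j i r ≡ ω (k i) ^ (toℕ r ℕ.* j)
    w-diagonal i j r with i Fin.≟ i
    ... | yes _  = pow≡^ (ω (k i)) (toℕ r ℕ.* j)
    ... | no i≢i = ⊥-elim (i≢i ≡.refl)

    w-off-diagonal : ∀ i j i′ r → i ≢ i′ → w R d k ω i j i′ r ≡ 0#
    w-off-diagonal i j i′ r i≢i′ with i Fin.≟ i′
    ... | yes i≡i′ = ⊥-elim (i≢i′ i≡i′)
    ... | no _     = ≡.refl

    ∑w-restrict : (α : (i : Fin d) → Vector K (k i ∸ 1)) → ∀ i′ (r : Fin (k i′)) →
      ∑ R d (λ i → ∑ R (k i ∸ 1) (λ t → α i t * w R d k ω i (suc (toℕ t)) i′ r))
      ≈ ∑[ t < k i′ ∸ 1 ] (α i′ t * ω (k i′) ^ (toℕ r ℕ.* suc (toℕ t)))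
    ∑w-restrict α i′ r = begin
      ∑ R d (λ i → ∑ R (k i ∸ 1) (λ t → α i t * w R d k ω i (suc (toℕ t)) i′ r))
        ≈⟨ reflexive (≡.trans (∑≡sum d _) (sum-cong-≗ λ i → ∑≡sum (k i ∸ 1) _)) ⟩
      ∑[ i < d ] ∑[ t < k i ∸ 1 ] (α i t * w R d k ω i (suc (toℕ t)) i′ r)
        ≈⟨ sum-select {d} _ i′ (λ i i≢i′ → sum-zero {k i ∸ 1} _ λ t →
             trans (*-congˡ (reflexive (w-off-diagonal i (suc (toℕ t)) i′ r i≢i′)))
                   (zeroʳ (α i t))) ⟩
      ∑[ t < k i′ ∸ 1 ] (α i′ t * w R d k ω i′ (suc (toℕ t)) i′ r)
        ≈⟨ sum-cong-≋ {k i′ ∸ 1} (λ t →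
             *-congˡ {α i′ t} (reflexive (w-diagonal i′ (suc (toℕ t)) r))) ⟩
      ∑[ t < k i′ ∸ 1 ] (α i′ t * ω (k i′) ^ (toℕ r ℕ.* suc (toℕ t))) ∎

  module _ (acf : IsACF0 R) where
    open IsACF0 acf

    almostCancelˡ : AlmostLeftCancellative 0# _*_
    almostCancelˡ = inverse⇒almostCancelˡ inverse

    natK≉0 : ∀ {k} → 1 ≤ k → ¬ natK R k ≈ 0#
    natK≉0 {suc k} _ = char0 k

proposition3p6 : {c ℓ : Level} (R : CommutativeRing c ℓ) → IsACF0 R →
    (ω : ℕ → CommutativeRing.Carrier R) → (∀ m → 1 ≤ m → IsPrimitiveRoot R m (ω m)) →
    (d : ℕ) → 1 ≤ d → (k : Fin d → ℕ) → (∀ i → 1 ≤ k i) →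
    (cc : (i : Fin d) → Fin (k i) → CommutativeRing.Carrier R) →
    (a : Fin d → Fin d → CommutativeRing.Carrier R) →
    (u : Fin d → Fin d → CommutativeRing.Carrier R) →
    IsBasis R u →
    (∀ l → IsGenEigenvector R (Abar R d k cc a) (u l)) →
    FamilyLinIndep R d k ω u
proposition3p6 R acf ω ω-primitive d _ k 1≤k _ _ u (independent , _) _ α β relation =
  proj₂ ∘ block , independent β (proj₁ ∘ block)
  where
  open CommutativeRing R using (_≈_; _*_; 0#; trans; sym; +-congʳ)
  block : ∀ i → ∑ R d (λ l → β l * u l i) ≈ 0# × (∀ t → α i t ≈ 0#)
  block i = fourier-basis-independent R (almostCancelˡ R acf) (natK≉0 R acf (1≤k i))
    (ω-primitive (k i) (1≤k i)) _ (α i)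
    (λ r → trans (+-congʳ (sym (∑w-restrict R {k = k} {ω = ω} α i r))) (relation i r))
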